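{- Let $\alpha$ be a dihedral ordering of $[n]$. Then there is an invertible monomial change of coordinates between the dihedral chart for $\alpha$ and the standard dihedral chart: a ring isomorphism $\phi_\alpha:\mathbb{C}[\mathcal{M}_{0,n}^\alpha]\to\mathbb{C}[\mathcal{M}_{0,n}]$ sending each generator $u^\alpha_{pq}$ to $\pm$ a Laurent monomial in the standard coordinates $u_{kl}$, with inverse of the same form, such that $\phi_\alpha(u^\alpha_{pq})$ and $u^\alpha_{pq}$ define the same function on $\mathcal{M}_{0,n}$.
   Context: $\mathcal{M}_{0,n}$ is the moduli space of $n$ distinct labeled points $z_1,\dots,z_n$ on $\mathbb{P}^1$ modulo $\mathrm{PGL}_2$, and $[ij|kl]=\frac{(z_i-z_k)(z_j-z_l)}{(z_i-z_l)(z_j-z_k)}$. Positions $1,\dots,n$ are taken cyclically mod $n$; a chord is an unordered pair $\{p,q\}$ of positions with $q\notin\{p-1,p,p+1\}$. A dihedral ordering is a bijection $\alpha$ from positions to labels $[n]$ (one-line notation $\alpha(1),\dots,\alpha(n)$), considered up to rotations and reflections. Its dihedral coordinates are $u^\alpha_{pq}=[\alpha(p),\alpha(p+1)\,|\,\alpha(q+1),\alpha(q)]$ for chords $pq$; for $\alpha=\mathrm{id}$ these are the standard coordinates $u_{pq}$. Each set of dihedral coordinates gives a closed embedding of $\mathcal{M}_{0,n}$ into a torus; $\mathbb{C}[\mathcal{M}^\alpha_{0,n}]$ denotes the coordinate ring of this embedded copy, generated by the $u^\alpha_{pq}$ and their inverses, and $\mathbb{C}[\mathcal{M}_{0,n}]$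 the one for $\alpha=\mathrm{id}$. -}

module Defs where

open import Level using (Level; _⊔_) renaming (suc to lsuc)
open import Algebra.Bundles using (CommutativeRing)
open import Data.Nat using (ℕ; zero; suc; _<ᵇ_)
open import Data.Nat.DivMod using (_%_; m%n<n)
open import Data.Fin using (Fin; toℕ; fromℕ<)
open import Data.Fin.Properties using (_≟_)
open import Data.Fin.Permutation using (Permutation′; _⟨$⟩ʳ_)
open import Data.Integer using (ℤ; +_; -[1+_])
open import Data.Sign using (Sign)
open import Data.Bool using (Bool; true; false; _∧_; not; if_then_else_; T)
open import Data.List using (List; allFin; foldr; map)
open import Relation.Nullary using (¬_)
open import Relation.Nullary.Decidable using (⌊_⌋)
open import Relation.Binary.PropositionalEquality using (_≢_)

record Field (c ℓ : Level) : Set (lsuc (c ⊔ ℓ)) where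
  field
    commutativeRing : CommutativeRing c ℓ
  open CommutativeRing commutativeRing public
  field
    _⁻¹        : Carrier → Carrier
    ⁻¹-inverse : ∀ x → ¬ (x ≈ 0#) → x * (x ⁻¹) ≈ 1#
    1≉0        : ¬ (1# ≈ 0#)

-- Cyclic positions 1..n are modelled by Fin n (position i+1 ↦ i).

next : {n : ℕ} → Fin n → Fin n
next {suc m} i = fromℕ< (m%n<n (suc (toℕ i)) (suc m))

-- Chords, represented by the ordered pair (p , q) with p < q:
-- q ∉ {p-1, p, p+1} cyclically.
isChord : {n : ℕ} → Fin n → Fin n → Bool
isChord p q = (toℕ p <ᵇ toℕ q) ∧ not ⌊ q ≟ next p ⌋ ∧ not ⌊ p ≟ next q ⌋

IsChord : {n : ℕ} → Fin n → Fin n → Set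
IsChord p q = T (isChord p q)

-- Dihedral orderings: bijections α from positions to labels.

DihedralOrdering : ℕ → Set
DihedralOrdering n = Permutation′ n

module _ {c ℓ : Level} (F : Field c ℓ) where
  open Field F

  Distinct : {n : ℕ} → (Fin n → Carrier) → Set ℓ
  Distinct {n} z = ∀ (i j : Fin n) → i ≢ j → ¬ (z i ≈ z j)

  _/_ : Carrier → Carrier → Carrier
  x / y = x * (y ⁻¹)

  crossRatio : {n : ℕ} → (Fin n → Carrier) → Fin n → Fin n → Fin n → Fin n → Carrier
  crossRatio z i j k l =
    ((z i - z k) * (z j - z l)) / ((z i - z l) * (z j - z k))

  uα : {n : ℕ} → DihedralOrdering n → (Fin n → Carrier) → Fin n → Fin n → Carrier
  uα α z p q = crossRatio z (α ⟨$⟩ʳ p) (α ⟨$⟩ʳ next p) (α ⟨$⟩ʳ next q) (α ⟨$⟩ʳ q)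

  u : {n : ℕ} → (Fin n → Carrier) → Fin n → Fin n → Carrier
  u z p q = crossRatio z p (next p) (next q) q

  _^ℕ_ : Carrier → ℕ → Carrier
  x ^ℕ zero  = 1#
  x ^ℕ suc k = x * (x ^ℕ k)

  _^ℤ_ : Carrier → ℤ → Carrier
  x ^ℤ (+ k)      = x ^ℕ k
  x ^ℤ (-[1+ k ]) = (x ⁻¹) ^ℕ suc k

  applySign : Sign → Carrier → Carrier
  applySign Sign.+ x = x
  applySign Sign.- x = - x

  monomial : {n : ℕ} → (Fin n → Fin n → Carrier) → (Fin n → Fin n → ℤ) → Carrier
  monomial {n} w e =
    foldr _*_ 1#
      (map (λ k → foldr _*_ 1#
              (map (λ l → if isChord k l then w k l ^ℤ e k l else 1#) (allFin n)))
           (allFin n))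

{-# OPTIONS --safe #-}
module Submission where

-- Each u^α_pq is a cross-ratio [a b | c d] of four distinct labels, and each u_kl is such a
-- cross-ratio for the configuration z ∘ α, whose standard coordinates are the u^α.  So it
-- suffices that every cross-ratio of four distinct points is ± a Laurent monomial in the u_kl.
-- For labels i < j < k < l one has [i j | l k] = ∏ u_xy over i ≤ x < j, k ≤ y < l, by
-- telescoping with the cocycle identities [ab|cd]·[ab|de] = [ab|ce] and [ab|cd]·[bx|cd] = [ax|cd];
-- the same product taken over an arc through position 0 gives [j k | i l].  The remaining
-- orderings of {i, j, k, l} follow from the Klein symmetries, [ab|cd]·[ab|dc] = 1 and the
-- three-term relation [ad|bc]·[ab|cd] = -[ac|bd].

open import Defs
open import Level using (Level)
open import Data.Nat using (ℕ)
open import Data.Fin using (Fin)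
open import Data.Integer using (ℤ)
open import Data.Sign using (Sign)
open import Data.Product using (Σ; _×_)

open import Level using (_⊔_)
open import Function using (_∘_; id; _⇔_; mk⇔; Injective; Equivalence)
open import Data.Empty using (⊥-elim)
open import Data.Sum using (inj₁; inj₂)
open import Data.Product using (_,_; proj₁; proj₂)
open import Data.Bool using (true; false; if_then_else_; not)
open import Data.Bool.Properties using (T-∧)
open import Data.Nat as ℕ using (zero; suc; _<_; _≤_; z≤n; s≤s; z<s)
import Data.Nat.Properties as ℕ
open import Data.Nat.DivMod using (_%_; m%n<n; m<n⇒m%n≡m; m%n%n≡m%n; n%n≡0; %-distribˡ-+)
open import Data.Fin as Fin using (toℕ; fromℕ<)
open import Data.Fin.Properties
  using (_≟_; toℕ-injective; toℕ<n; toℕ-fromℕ<; suc-injective; <⇒≢; <-cmp)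
open import Data.Fin.Permutation using (Permutation′; _⟨$⟩ʳ_; _⟨$⟩ˡ_; inverseˡ; inverseʳ; flip)
open import Data.Integer as ℤ using (+_; -[1+_]; _⊖_)
import Data.Integer.Properties as ℤ
open import Data.Sign as Sign using ()
open import Data.Sign.Properties using (s*s≡+)
open import Data.List using (foldr; map; allFin; tabulate)
open import Relation.Nullary using (¬_; yes; no)
open import Relation.Nullary.Decidable using (T?; ⌊_⌋; toWitnessFalse; fromWitnessFalse)
open import Relation.Binary.Definitions using (tri<; tri≈; tri>)
open import Relation.Binary.PropositionalEquality as ≡ using (_≡_; _≢_; ≢-sym)

module FieldProperties {c ℓ : Level} (F : Field c ℓ) where
  open Field F
  open import Algebra.Properties.Ring ring
    using (-‿distribˡ-*; -‿distribʳ-*; -‿involutive; -0#≈0#; ⁻¹-anti-homo‿-; x∙y⁻¹≈ε⇒x≈y)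
  open import Algebra.Properties.CommutativeSemigroup *-commutativeSemigroup using (interchange)
  open import Algebra.Solver.CommutativeMonoid *-commutativeMonoid using (solve; _⊜_; _⊕_)
  open import Relation.Binary.Reasoning.Setoid setoid

  -x*-y≈x*y : ∀ x y → - x * - y ≈ x * y
  -x*-y≈x*y x y = begin
    - x * - y      ≈⟨ -‿distribˡ-* x (- y) ⟨
    - (x * - y)    ≈⟨ -‿cong (-‿distribʳ-* x y) ⟨
    - - (x * y)    ≈⟨ -‿involutive (x * y) ⟩
    x * y          ∎

  x-y≈-[y-x] : ∀ x y → x - y ≈ - (y - x)
  x-y≈-[y-x] x y = sym (⁻¹-anti-homo‿- y x)

  x*[y-z]≈-[x*[z-y]] : ∀ x y z → x * (y - z) ≈ - (x * (z - y))
  x*[y-z]≈-[x*[z-y]] x y z = trans (*-congˡ (x-y≈-[y-x] y z)) (sym (-‿distribʳ-* x (z - y)))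

  [x-y]*[w-v]≈[y-x]*[v-w] : ∀ x y w v → (x - y) * (w - v) ≈ (y - x) * (v - w)
  [x-y]*[w-v]≈[y-x]*[v-w] x y w v =
    trans (*-cong (x-y≈-[y-x] x y) (x-y≈-[y-x] w v)) (-x*-y≈x*y (y - x) (v - w))

  x≉y⇒x-y≉0 : ∀ {x y} → x ≉ y → x - y ≉ 0#
  x≉y⇒x-y≉0 x≉y x-y≈0 = x≉y (x∙y⁻¹≈ε⇒x≈y _ _ x-y≈0)

  -‿≉0 : ∀ {x} → x ≉ 0# → - x ≉ 0#
  -‿≉0 {x} x≉0 -x≈0 = x≉0 (begin
    x        ≈⟨ -‿involutive x ⟨
    - - x    ≈⟨ -‿cong -x≈0 ⟩
    - 0#     ≈⟨ -0#≈0# ⟩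
    0#       ∎)

  *-≉0 : ∀ {x y} → x ≉ 0# → y ≉ 0# → x * y ≉ 0#
  *-≉0 {x} {y} x≉0 y≉0 xy≈0 = y≉0 (begin
    y               ≈⟨ *-identityˡ y ⟨
    1# * y          ≈⟨ *-congʳ (trans (*-comm (x ⁻¹) x) (⁻¹-inverse x x≉0)) ⟨
    x ⁻¹ * x * y    ≈⟨ *-assoc (x ⁻¹) x y ⟩
    x ⁻¹ * (x * y)  ≈⟨ *-congˡ xy≈0 ⟩
    x ⁻¹ * 0#       ≈⟨ zeroʳ (x ⁻¹) ⟩
    0#              ∎)

  ⁻¹-≉0 : ∀ {x} → x ≉ 0# → x ⁻¹ ≉ 0#
  ⁻¹-≉0 {x} x≉0 x⁻¹≈0 = 1≉0 (begin
    1#          ≈⟨ ⁻¹-inverse x x≉0 ⟨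
    x * x ⁻¹    ≈⟨ *-congˡ x⁻¹≈0 ⟩
    x * 0#      ≈⟨ zeroʳ x ⟩
    0#          ∎)

  inverse-unique : ∀ {x y y′} → x * y ≈ 1# → x * y′ ≈ 1# → y ≈ y′
  inverse-unique {x} {y} {y′} xy≈1 xy′≈1 = begin
    y              ≈⟨ *-identityʳ y ⟨
    y * 1#         ≈⟨ *-congˡ xy′≈1 ⟨
    y * (x * y′)   ≈⟨ *-assoc y x y′ ⟨
    y * x * y′     ≈⟨ *-congʳ (trans (*-comm y x) xy≈1) ⟩
    1# * y′        ≈⟨ *-identityˡ y′ ⟩
    y′             ∎

  -- The field axioms do not make _⁻¹ a congruence; off 0 it is one by uniqueness of inverses.
  ⁻¹-cong : ∀ {x y} → x ≉ 0# → x ≈ y → x ⁻¹ ≈ y ⁻¹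
  ⁻¹-cong {x} {y} x≉0 x≈y = inverse-unique (⁻¹-inverse x x≉0)
    (trans (*-congʳ x≈y) (⁻¹-inverse y (λ y≈0 → x≉0 (trans x≈y y≈0))))

  ⁻¹-distrib-* : ∀ {x y} → x ≉ 0# → y ≉ 0# → (x * y) ⁻¹ ≈ x ⁻¹ * y ⁻¹
  ⁻¹-distrib-* {x} {y} x≉0 y≉0 = inverse-unique (⁻¹-inverse (x * y) (*-≉0 x≉0 y≉0)) (begin
    x * y * (x ⁻¹ * y ⁻¹)    ≈⟨ interchange x y (x ⁻¹) (y ⁻¹) ⟩
    x * x ⁻¹ * (y * y ⁻¹)    ≈⟨ *-cong (⁻¹-inverse x x≉0) (⁻¹-inverse y y≉0) ⟩
    1# * 1#                  ≈⟨ *-identityˡ 1# ⟩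
    1#                       ∎)

  -‿⁻¹ : ∀ {x} → x ≉ 0# → (- x) ⁻¹ ≈ - (x ⁻¹)
  -‿⁻¹ {x} x≉0 = inverse-unique (⁻¹-inverse (- x) (-‿≉0 x≉0))
    (trans (-x*-y≈x*y x (x ⁻¹)) (⁻¹-inverse x x≉0))

  /-cross : ∀ {p q r s} → q ≉ 0# → s ≉ 0# → p * s ≈ r * q → p * q ⁻¹ ≈ r * s ⁻¹
  /-cross {p} {q} {r} {s} q≉0 s≉0 ps≈rq = begin
    p * q ⁻¹                  ≈⟨ *-identityʳ _ ⟨
    p * q ⁻¹ * 1#             ≈⟨ *-congˡ (⁻¹-inverse s s≉0) ⟨
    p * q ⁻¹ * (s * s ⁻¹)     ≈⟨ interchange p (q ⁻¹) s (s ⁻¹) ⟩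
    p * s * (q ⁻¹ * s ⁻¹)     ≈⟨ *-congʳ ps≈rq ⟩
    r * q * (q ⁻¹ * s ⁻¹)
      ≈⟨ solve 4 (λ r q q′ s′ → (r ⊕ q) ⊕ (q′ ⊕ s′) ⊜ (r ⊕ s′) ⊕ (q ⊕ q′)) refl r q (q ⁻¹) (s ⁻¹) ⟩
    r * s ⁻¹ * (q * q ⁻¹)     ≈⟨ *-congˡ (⁻¹-inverse q q≉0) ⟩
    r * s ⁻¹ * 1#             ≈⟨ *-identityʳ _ ⟩
    r * s ⁻¹                  ∎

  /-*-/ : ∀ {p q r s} → q ≉ 0# → s ≉ 0# → p * q ⁻¹ * (r * s ⁻¹) ≈ p * r * (q * s) ⁻¹
  /-*-/ {p} {q} {r} {s} q≉0 s≉0 =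
    trans (interchange p (q ⁻¹) r (s ⁻¹)) (*-congˡ (sym (⁻¹-distrib-* q≉0 s≉0)))

  /-*-/-cancel : ∀ {x y w} → y ≉ 0# → x * y ⁻¹ * (y * w ⁻¹) ≈ x * w ⁻¹
  /-*-/-cancel {x} {y} {w} y≉0 = begin
    x * y ⁻¹ * (y * w ⁻¹)
      ≈⟨ solve 4 (λ x y′ y w′ → (x ⊕ y′) ⊕ (y ⊕ w′) ⊜ (x ⊕ w′) ⊕ (y ⊕ y′)) refl x (y ⁻¹) y (w ⁻¹) ⟩
    x * w ⁻¹ * (y * y ⁻¹)   ≈⟨ *-congˡ (⁻¹-inverse y y≉0) ⟩
    x * w ⁻¹ * 1#           ≈⟨ *-identityʳ _ ⟩
    x * w ⁻¹                ∎

  /-reciprocal : ∀ {p q} → p ≉ 0# → q ≉ 0# → p * q ⁻¹ * (q * p ⁻¹) ≈ 1#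
  /-reciprocal {p} {q} p≉0 q≉0 = trans (/-*-/-cancel q≉0) (⁻¹-inverse p p≉0)

  /-neg : ∀ {x y} → y ≉ 0# → x * (- y) ⁻¹ ≈ - (x * y ⁻¹)
  /-neg {x} {y} y≉0 = trans (*-congˡ (-‿⁻¹ y≉0)) (sym (-‿distribʳ-* x (y ⁻¹)))

  neg-/-neg : ∀ {x y} → y ≉ 0# → (- x) * (- y) ⁻¹ ≈ x * y ⁻¹
  neg-/-neg {x} {y} y≉0 = trans (*-congˡ (-‿⁻¹ y≉0)) (-x*-y≈x*y x (y ⁻¹))

  applySign-cong : ∀ s {x y} → x ≈ y → applySign F s x ≈ applySign F s y
  applySign-cong Sign.+ x≈y = x≈y
  applySign-cong Sign.- x≈y = -‿cong x≈y

  applySign-opposite : ∀ s x → applySign F (Sign.opposite s) x ≈ - applySign F s x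
  applySign-opposite Sign.+ x = refl
  applySign-opposite Sign.- x = sym (-‿involutive x)

  applySign-* : ∀ s t x y → applySign F s x * applySign F t y ≈ applySign F (s Sign.* t) (x * y)
  applySign-* Sign.+ Sign.+ x y = refl
  applySign-* Sign.+ Sign.- x y = sym (-‿distribʳ-* x y)
  applySign-* Sign.- Sign.+ x y = sym (-‿distribˡ-* x y)
  applySign-* Sign.- Sign.- x y = -x*-y≈x*y x y

module Monomials {c ℓ : Level} (F : Field c ℓ) where
  open Field F
  open FieldProperties F
  open import Algebra.Properties.CommutativeSemigroup *-commutativeSemigroup using (interchange)
  open import Algebra.Properties.CommutativeMonoid.Sum *-commutativeMonoid
    using () renaming (sum to ∏; sum-cong-≋ to ∏-cong; ∑-distrib-+ to ∏-distrib-*;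
                       sum-replicate-zero to ∏-replicate-1)
  open import Relation.Binary.Reasoning.Setoid setoid

  ∏-1 : ∀ {n} {f : Fin n → Carrier} → (∀ i → f i ≈ 1#) → ∏ f ≈ 1#
  ∏-1 {n} f≈1 = trans (∏-cong f≈1) (∏-replicate-1 n)

  ∏-single : ∀ {n} (f : Fin n → Carrier) i → (∀ j → j ≢ i → f j ≈ 1#) → ∏ f ≈ f i
  ∏-single f Fin.zero    f≈1 = trans (*-congˡ (∏-1 λ j → f≈1 (Fin.suc j) λ ())) (*-identityʳ _)
  ∏-single f (Fin.suc i) f≈1 = trans (*-congʳ (f≈1 Fin.zero λ ())) (trans (*-identityˡ _)
    (∏-single (f ∘ Fin.suc) i λ j j≢i → f≈1 (Fin.suc j) (j≢i ∘ suc-injective)))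

  foldr-map-tabulate : ∀ {a} {A : Set a} {n} (f : A → Carrier) (g : Fin n → A) →
                       foldr _*_ 1# (map f (tabulate g)) ≡ ∏ (f ∘ g)
  foldr-map-tabulate {n = zero}  f g = ≡.refl
  foldr-map-tabulate {n = suc n} f g = ≡.cong (f (g Fin.zero) *_) (foldr-map-tabulate f (g ∘ Fin.suc))

  ^ℕ-+ : ∀ x m k → _^ℕ_ F x (m ℕ.+ k) ≈ _^ℕ_ F x m * _^ℕ_ F x k
  ^ℕ-+ x zero    k = sym (*-identityˡ _)
  ^ℕ-+ x (suc m) k = trans (*-congˡ (^ℕ-+ x m k)) (sym (*-assoc _ _ _))

  ^ℕ-⊖ : ∀ {x} → x ≉ 0# → ∀ m k → _^ℕ_ F x m * _^ℕ_ F (x ⁻¹) k ≈ _^ℤ_ F x (m ⊖ k)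
  ^ℕ-⊖ x≉0 m       zero    = *-identityʳ _
  ^ℕ-⊖ x≉0 zero    (suc k) = *-identityˡ _
  ^ℕ-⊖ {x} x≉0 (suc m) (suc k) = begin
    x * xᵐ * (x ⁻¹ * x⁻ᵏ)     ≈⟨ interchange x xᵐ (x ⁻¹) x⁻ᵏ ⟩
    x * x ⁻¹ * (xᵐ * x⁻ᵏ)     ≈⟨ *-congʳ (⁻¹-inverse x x≉0) ⟩
    1# * (xᵐ * x⁻ᵏ)           ≈⟨ *-identityˡ _ ⟩
    xᵐ * x⁻ᵏ                  ≈⟨ ^ℕ-⊖ x≉0 m k ⟩
    _^ℤ_ F x (m ⊖ k)          ≡⟨ ≡.cong (_^ℤ_ F x) (ℤ.[1+m]⊖[1+n]≡m⊖n m k) ⟨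
    _^ℤ_ F x (suc m ⊖ suc k)  ∎
    where
    xᵐ  = _^ℕ_ F x m
    x⁻ᵏ = _^ℕ_ F (x ⁻¹) k

  ^ℤ-+ : ∀ {x} → x ≉ 0# → ∀ a b → _^ℤ_ F x (a ℤ.+ b) ≈ _^ℤ_ F x a * _^ℤ_ F x b
  ^ℤ-+ {x} x≉0 (+ m)    (+ k)    = ^ℕ-+ x m k
  ^ℤ-+ {x} x≉0 (+ m)    -[1+ k ] = sym (^ℕ-⊖ x≉0 m (suc k))
  ^ℤ-+ {x} x≉0 -[1+ m ] (+ k)    = trans (sym (^ℕ-⊖ x≉0 k (suc m))) (*-comm _ _)
  ^ℤ-+ {x} x≉0 -[1+ m ] -[1+ k ] = begin
    _^ℕ_ F (x ⁻¹) (suc (suc (m ℕ.+ k)))  ≡⟨ ≡.cong (_^ℕ_ F (x ⁻¹) ∘ suc) (ℕ.+-suc m k) ⟨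
    _^ℕ_ F (x ⁻¹) (suc m ℕ.+ suc k)      ≈⟨ ^ℕ-+ (x ⁻¹) (suc m) (suc k) ⟩
    _^ℕ_ F (x ⁻¹) (suc m) * _^ℕ_ F (x ⁻¹) (suc k)  ∎

  module _ {n : ℕ} where

    factor : (Fin n → Fin n → Carrier) → (Fin n → Fin n → ℤ) → Fin n → Fin n → Carrier
    factor w e k l = if isChord k l then _^ℤ_ F (w k l) (e k l) else 1#

    monomial≈∏∏ : ∀ w e → monomial F w e ≈ ∏ λ k → ∏ λ l → factor w e k l
    monomial≈∏∏ w e = begin
      monomial F w e
        ≡⟨ foldr-map-tabulate (λ k → foldr _*_ 1# (map (factor w e k) (allFin n))) id ⟩
      ∏ (λ k → foldr _*_ 1# (map (factor w e k) (allFin n)))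
        ≈⟨ ∏-cong (λ k → reflexive (foldr-map-tabulate (factor w e k) id)) ⟩
      ∏ (λ k → ∏ (factor w e k))
        ∎

    factor-0 : ∀ w e k l → e k l ≡ + 0 → factor w e k l ≈ 1#
    factor-0 w e k l e≡0 with isChord k l
    ... | true  = reflexive (≡.cong (_^ℤ_ F (w k l)) e≡0)
    ... | false = refl

    factor-chord : ∀ w e k l → IsChord k l → factor w e k l ≡ _^ℤ_ F (w k l) (e k l)
    factor-chord w e k l kl with isChord k l
    ... | true = ≡.refl

    NonzeroOnChords : (Fin n → Fin n → Carrier) → Set ℓ
    NonzeroOnChords w = ∀ k l → IsChord k l → w k l ≉ 0#

    monomial-+ : ∀ {w} → NonzeroOnChords w → ∀ e e′ →
                 monomial F w (λ k l → e k l ℤ.+ e′ k l) ≈ monomial F w e * monomial F w e′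
    monomial-+ {w} w≉0 e e′ = begin
      monomial F w e+e′
        ≈⟨ monomial≈∏∏ w e+e′ ⟩
      ∏ (λ k → ∏ (factor w e+e′ k))
        ≈⟨ ∏-cong (λ k → ∏-cong (factor-+ k)) ⟩
      ∏ (λ k → ∏ (λ l → factor w e k l * factor w e′ k l))
        ≈⟨ ∏-cong (λ k → ∏-distrib-* (factor w e k) (factor w e′ k)) ⟩
      ∏ (λ k → ∏ (factor w e k) * ∏ (factor w e′ k))
        ≈⟨ ∏-distrib-* (∏ ∘ factor w e) (∏ ∘ factor w e′) ⟩
      ∏ (λ k → ∏ (factor w e k)) * ∏ (λ k → ∏ (factor w e′ k))
        ≈⟨ *-cong (monomial≈∏∏ w e) (monomial≈∏∏ w e′) ⟨
      monomial F w e * monomial F w e′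
        ∎
      where
      e+e′ = λ k l → e k l ℤ.+ e′ k l
      factor-+ : ∀ k l → factor w e+e′ k l ≈ factor w e k l * factor w e′ k l
      factor-+ k l with isChord k l | w≉0 k l
      ... | true  | kl⇒≉0 = ^ℤ-+ (kl⇒≉0 _) (e k l) (e′ k l)
      ... | false | _     = sym (*-identityˡ 1#)

    monomial-0 : ∀ w → monomial F w (λ _ _ → + 0) ≈ 1#
    monomial-0 w = trans (monomial≈∏∏ w zero-exponent)
                         (∏-1 λ k → ∏-1 λ l → factor-0 w zero-exponent k l ≡.refl)
      where
      zero-exponent = λ (_ _ : Fin n) → + 0

    monomial-cong : ∀ w {e e′} → (∀ k l → e k l ≡ e′ k l) → monomial F w e ≈ monomial F w e′
    monomial-cong w {e} {e′} e≡e′ = begin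
      monomial F w e
        ≈⟨ monomial≈∏∏ w e ⟩
      ∏ (λ k → ∏ (factor w e k))
        ≈⟨ ∏-cong (λ k → ∏-cong λ l → reflexive (≡.cong (factor-at k l) (e≡e′ k l))) ⟩
      ∏ (λ k → ∏ (factor w e′ k))
        ≈⟨ monomial≈∏∏ w e′ ⟨
      monomial F w e′
        ∎
      where
      factor-at : ∀ k l → ℤ → Carrier
      factor-at k l i = factor w (λ _ _ → i) k l

    indicator : Fin n → Fin n → Fin n → Fin n → ℤ
    indicator p q k l with k ≟ p | l ≟ q
    ... | yes _ | yes _ = + 1
    ... | _     | _     = + 0

    indicator-off : ∀ {p q k l} → ¬ (k ≡ p × l ≡ q) → indicator p q k l ≡ + 0
    indicator-off {p} {q} {k} {l} ¬k≡p×l≡q with k ≟ p | l ≟ q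
    ... | yes k≡p | yes l≡q = ⊥-elim (¬k≡p×l≡q (k≡p , l≡q))
    ... | yes _   | no _    = ≡.refl
    ... | no _    | _       = ≡.refl

    indicator-on : ∀ p q → indicator p q p q ≡ + 1
    indicator-on p q with p ≟ p | q ≟ q
    ... | yes _   | yes _   = ≡.refl
    ... | yes _   | no q≢q  = ⊥-elim (q≢q ≡.refl)
    ... | no p≢p  | _       = ⊥-elim (p≢p ≡.refl)

    monomial-indicator : ∀ w {p q} → IsChord p q → monomial F w (indicator p q) ≈ w p q
    monomial-indicator w {p} {q} pq = begin
      monomial F w δ              ≈⟨ monomial≈∏∏ w δ ⟩
      ∏ (λ k → ∏ (factor w δ k))  ≈⟨ ∏-single _ p (λ k k≢p → ∏-1 λ l → off k l (k≢p ∘ proj₁)) ⟩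
      ∏ (factor w δ p)            ≈⟨ ∏-single _ q (λ l l≢q → off p l (l≢q ∘ proj₂)) ⟩
      factor w δ p q              ≡⟨ factor-chord w δ p q pq ⟩
      _^ℤ_ F (w p q) (δ p q)      ≡⟨ ≡.cong (_^ℤ_ F (w p q)) (indicator-on p q) ⟩
      w p q * 1#                  ≈⟨ *-identityʳ (w p q) ⟩
      w p q                       ∎
      where
      δ = indicator p q
      off : ∀ k l → ¬ (k ≡ p × l ≡ q) → factor w δ k l ≈ 1#
      off k l ¬k≡p×l≡q = factor-0 w δ k l (indicator-off ¬k≡p×l≡q)

Distinct4 : ∀ {a} {A : Set a} → A → A → A → A → Set a
Distinct4 a b c d = a ≢ b × a ≢ c × a ≢ d × b ≢ c × b ≢ d × c ≢ d

Distinct4-map : ∀ {A B : Set} {f : A → B} → Injective _≡_ _≡_ f →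
                ∀ {a b c d} → Distinct4 a b c d → Distinct4 (f a) (f b) (f c) (f d)
Distinct4-map f-injective (a≢b , a≢c , a≢d , b≢c , b≢d , c≢d) =
  a≢b ∘ f-injective , a≢c ∘ f-injective , a≢d ∘ f-injective ,
  b≢c ∘ f-injective , b≢d ∘ f-injective , c≢d ∘ f-injective

Distinct4-badc : ∀ {a} {A : Set a} {a b c d : A} → Distinct4 a b c d → Distinct4 b a d c
Distinct4-badc (a≢b , a≢c , a≢d , b≢c , b≢d , c≢d) =
  ≢-sym a≢b , b≢d , b≢c , a≢d , a≢c , ≢-sym c≢d

IsChord⇔ : ∀ {n} {p q : Fin n} → IsChord p q ⇔ (toℕ p < toℕ q × q ≢ next p × p ≢ next q)
IsChord⇔ {p = p} {q} = mk⇔ to from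
  where
  to : IsChord p q → toℕ p < toℕ q × q ≢ next p × p ≢ next q
  to pq with Equivalence.to (T-∧ {toℕ p ℕ.<ᵇ toℕ q}) pq
  ... | p<q , rest with Equivalence.to (T-∧ {not ⌊ q ≟ next p ⌋}) rest
  ...   | q≢p⁺ , p≢q⁺ = ℕ.<ᵇ⇒< _ _ p<q , toWitnessFalse q≢p⁺ , toWitnessFalse p≢q⁺
  from : toℕ p < toℕ q × q ≢ next p × p ≢ next q → IsChord p q
  from (p<q , q≢p⁺ , p≢q⁺) = Equivalence.from (T-∧ {toℕ p ℕ.<ᵇ toℕ q})
    ( ℕ.<⇒<ᵇ p<q
    , Equivalence.from (T-∧ {not ⌊ q ≟ next p ⌋}) (fromWitnessFalse q≢p⁺ , fromWitnessFalse p≢q⁺))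

-- Positions are indexed by all of ℕ, read modulo N; by definition `next i` is `pos (suc (toℕ i))`.
module Positions (m : ℕ) where
  open ≡.≡-Reasoning

  N : ℕ
  N = suc m

  pos : ℕ → Fin N
  pos x = fromℕ< (m%n<n x N)

  toℕ-pos : ∀ x → toℕ (pos x) ≡ x % N
  toℕ-pos x = toℕ-fromℕ< _

  toℕ-pos-< : ∀ {x} → x < N → toℕ (pos x) ≡ x
  toℕ-pos-< {x} x<N = ≡.trans (toℕ-pos x) (m<n⇒m%n≡m x<N)

  pos-toℕ : ∀ i → pos (toℕ i) ≡ i
  pos-toℕ i = toℕ-injective (toℕ-pos-< (toℕ<n i))

  pos-N : pos N ≡ Fin.zero
  pos-N = toℕ-injective (≡.trans (toℕ-pos N) (n%n≡0 N))

  next-pos : ∀ x → next (pos x) ≡ pos (suc x)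
  next-pos x = toℕ-injective (begin
    toℕ (next (pos x))            ≡⟨ toℕ-pos (suc (toℕ (pos x))) ⟩
    suc (toℕ (pos x)) % N         ≡⟨ ≡.cong (λ y → suc y % N) (toℕ-pos x) ⟩
    suc (x % N) % N               ≡⟨ %-distribˡ-+ 1 (x % N) N ⟩
    (1 % N ℕ.+ x % N % N) % N     ≡⟨ ≡.cong (λ y → (1 % N ℕ.+ y) % N) (m%n%n≡m%n x N) ⟩
    (1 % N ℕ.+ x % N) % N         ≡⟨ %-distribˡ-+ 1 x N ⟨
    suc x % N                     ≡⟨ toℕ-pos (suc x) ⟨
    toℕ (pos (suc x))             ∎)

  -- y = N is allowed: it is position 0 again.
  pos-distinct : ∀ {x y} → x < y → y ≤ N → y < N ℕ.+ x → pos x ≢ pos y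
  pos-distinct {x} {y} x<y y≤N y<N+x x≡y with ℕ.m≤n⇒m<n∨m≡n y≤N
  ... | inj₁ y<N = ℕ.<⇒≢ x<y (begin
    x              ≡⟨ toℕ-pos-< (ℕ.<-trans x<y y<N) ⟨
    toℕ (pos x)    ≡⟨ ≡.cong toℕ x≡y ⟩
    toℕ (pos y)    ≡⟨ toℕ-pos-< y<N ⟩
    y              ∎)
  ... | inj₂ ≡.refl =
    ℕ.<-irrefl (≡.sym (ℕ.+-identityʳ N)) (≡.subst (λ x → N < N ℕ.+ x) x≡0 y<N+x)
    where
    x≡0 : x ≡ 0
    x≡0 = begin
      x              ≡⟨ toℕ-pos-< x<y ⟨
      toℕ (pos x)    ≡⟨ ≡.cong toℕ (≡.trans x≡y pos-N) ⟩
      0              ∎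

chord-distinct : ∀ {n} {p q : Fin n} → IsChord p q → Distinct4 p (next p) (next q) q
chord-distinct {suc m} {p} {q} pq = p≢p⁺ , p≢q⁺ , p≢q , p⁺≢q⁺ , ≢-sym q≢p⁺ , ≢-sym q≢q⁺
  where
  open Positions m
  a = toℕ p
  b = toℕ q
  facts = Equivalence.to IsChord⇔ pq
  a<b = proj₁ facts
  q≢p⁺ = proj₁ (proj₂ facts)
  p≢q⁺ = proj₂ (proj₂ facts)
  b<N = toℕ<n q
  0<m : 0 < m
  0<m = ℕ.<-≤-trans (ℕ.≤-<-trans z≤n a<b) (ℕ.≤-pred b<N)
  p≢p⁺ : p ≢ next p
  p≢p⁺ = ≡.subst (_≢ next p) (pos-toℕ p)
           (pos-distinct (ℕ.n<1+n a) (ℕ.<-trans a<b b<N) (s≤s (ℕ.m<n+m a 0<m)))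
  p≢q : p ≢ q
  p≢q = ℕ.<⇒≢ a<b ∘ ≡.cong toℕ
  p⁺≢q⁺ : next p ≢ next q
  p⁺≢q⁺ = pos-distinct (s≤s a<b) b<N (ℕ.≤-<-trans b<N (ℕ.m<m+n N z<s))
  q≢q⁺ : q ≢ next q
  q≢q⁺ = ≡.subst (_≢ next q) (pos-toℕ q) (pos-distinct (ℕ.n<1+n b) b<N (s≤s (ℕ.m<n+m b 0<m)))

module CrossRatios {c ℓ : Level} (F : Field c ℓ) where
  open Field F
  open FieldProperties F
  open import Algebra.Properties.Ring ring using (-‿involutive)
  open import Algebra.Solver.CommutativeMonoid *-commutativeMonoid using (solve; _⊜_; _⊕_)
  open import Relation.Binary.Reasoning.Setoid setoid

  module _ {n} {z : Fin n → Carrier} (z-distinct : Distinct F z) where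

    cr : Fin n → Fin n → Fin n → Fin n → Carrier
    cr = crossRatio F z

    apart : ∀ {i j} → i ≢ j → z i - z j ≉ 0#
    apart {i} {j} i≢j = x≉y⇒x-y≉0 (z-distinct i j i≢j)

    apart² : ∀ {i j k l} → i ≢ j → k ≢ l → (z i - z j) * (z k - z l) ≉ 0#
    apart² i≢j k≢l = *-≉0 (apart i≢j) (apart k≢l)

    crossRatio-≉0 : ∀ {a b c d} → a ≢ c → b ≢ d → a ≢ d → b ≢ c → cr a b c d ≉ 0#
    crossRatio-≉0 a≢c b≢d a≢d b≢c = *-≉0 (apart² a≢c b≢d) (⁻¹-≉0 (apart² a≢d b≢c))

    crossRatio-cocycleʳ : ∀ {a b c d e} → a ≢ d → b ≢ c → a ≢ e → b ≢ d →
                          cr a b c d * cr a b d e ≈ cr a b c e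
    crossRatio-cocycleʳ {a} {b} {c} {d} {e} a≢d b≢c a≢e b≢d = begin
      cr a b c d * cr a b d e
          ≈⟨ /-*-/ (apart² a≢d b≢c) (apart² a≢e b≢d) ⟩
      AC * BD * (AD * BE) * (AD * BC * (AE * BD)) ⁻¹
          ≈⟨ /-cross (*-≉0 (apart² a≢d b≢c) (apart² a≢e b≢d)) (apart² a≢e b≢c)
               (solve 6 (λ ac bd ad be ae bc →
                  ((ac ⊕ bd) ⊕ (ad ⊕ be)) ⊕ (ae ⊕ bc) ⊜ (ac ⊕ be) ⊕ ((ad ⊕ bc) ⊕ (ae ⊕ bd)))
                  refl AC BD AD BE AE BC) ⟩
      cr a b c e
          ∎
      where
      AC = z a - z c
      BD = z b - z d
      AD = z a - z d
      BE = z b - z e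
      AE = z a - z e
      BC = z b - z c

    crossRatio-cocycleˡ : ∀ {a b x c d} → a ≢ d → b ≢ c → b ≢ d → x ≢ c →
                          cr a b c d * cr b x c d ≈ cr a x c d
    crossRatio-cocycleˡ {a} {b} {x} {c} {d} a≢d b≢c b≢d x≢c = begin
      cr a b c d * cr b x c d
          ≈⟨ /-*-/ (apart² a≢d b≢c) (apart² b≢d x≢c) ⟩
      AC * BD * (BC * XD) * (AD * BC * (BD * XC)) ⁻¹
          ≈⟨ /-cross (*-≉0 (apart² a≢d b≢c) (apart² b≢d x≢c)) (apart² a≢d x≢c)
               (solve 6 (λ ac bd bc xd ad xc →
                  ((ac ⊕ bd) ⊕ (bc ⊕ xd)) ⊕ (ad ⊕ xc) ⊜ (ac ⊕ xd) ⊕ ((ad ⊕ bc) ⊕ (bd ⊕ xc)))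
                  refl AC BD BC XD AD XC) ⟩
      cr a x c d
          ∎
      where
      AC = z a - z c
      BD = z b - z d
      BC = z b - z c
      XD = z x - z d
      AD = z a - z d
      XC = z x - z c

    crossRatio-reciprocal : ∀ {a b c d} → a ≢ c → b ≢ d → a ≢ d → b ≢ c →
                            cr a b c d * cr a b d c ≈ 1#
    crossRatio-reciprocal a≢c b≢d a≢d b≢c = /-reciprocal (apart² a≢c b≢d) (apart² a≢d b≢c)

    crossRatio-badc : ∀ {a b c d} → a ≢ d → b ≢ c → cr a b c d ≈ cr b a d c
    crossRatio-badc a≢d b≢c = *-cong (*-comm _ _) (⁻¹-cong (apart² a≢d b≢c) (*-comm _ _))

    crossRatio-cdab : ∀ {a b c d} → a ≢ d → b ≢ c → cr a b c d ≈ cr c d a b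
    crossRatio-cdab {a} {b} {c} {d} a≢d b≢c =
      *-cong ([x-y]*[w-v]≈[y-x]*[v-w] (z a) (z c) (z b) (z d))
             (⁻¹-cong (apart² a≢d b≢c)
                      (trans ([x-y]*[w-v]≈[y-x]*[v-w] (z a) (z d) (z b) (z c)) (*-comm _ _)))

    -- Both sides reduce to (AB·CD)/(AD·BC): the left up to two sign flips, the right up to one.
    crossRatio-three-term : ∀ {a b c d} → a ≢ c → b ≢ d → a ≢ d → b ≢ c →
                            cr a d b c * cr a b c d ≈ - cr a c b d
    crossRatio-three-term {a} {b} {c} {d} a≢c b≢d a≢d b≢c = begin
      cr a d b c * cr a b c d                   ≈⟨ *-congʳ cr-adbc ⟩
      AB * CD * (AC * BD) ⁻¹ * cr a b c d       ≈⟨ /-*-/-cancel (apart² a≢c b≢d) ⟩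
      AB * CD * (AD * BC) ⁻¹                    ≈⟨ -‿involutive _ ⟨
      - - (AB * CD * (AD * BC) ⁻¹)              ≈⟨ -‿cong cr-acbd ⟨
      - cr a c b d                              ∎
      where
      AB = z a - z b
      CD = z c - z d
      AC = z a - z c
      BD = z b - z d
      AD = z a - z d
      BC = z b - z c
      cr-adbc : cr a d b c ≈ AB * CD * (AC * BD) ⁻¹
      cr-adbc = trans
        (*-cong (x*[y-z]≈-[x*[z-y]] AB (z d) (z c))
                (⁻¹-cong (apart² a≢c (≢-sym b≢d)) (x*[y-z]≈-[x*[z-y]] AC (z d) (z b))))
        (neg-/-neg (apart² a≢c b≢d))
      cr-acbd : cr a c b d ≈ - (AB * CD * (AD * BC) ⁻¹)
      cr-acbd = trans
        (*-congˡ (⁻¹-cong (apart² a≢d (≢-sym b≢c)) (x*[y-z]≈-[x*[z-y]] AD (z c) (z b))))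
        (/-neg (apart² a≢d b≢c))

module SignedMonomials {c ℓ : Level} (F : Field c ℓ) (n : ℕ) where
  open Field F
  open FieldProperties F
  open Monomials F
  open CrossRatios F
  open import Algebra.Properties.Ring ring using (-‿involutive)
  open import Relation.Binary.Reasoning.Setoid setoid

  Configuration : Set c
  Configuration = Fin n → Carrier

  signedMonomial : Sign → (Fin n → Fin n → ℤ) → Configuration → Carrier
  signedMonomial s e z = applySign F s (monomial F (u F z) e)

  record SignedMonomial (f : Configuration → Carrier) : Set (c ⊔ ℓ) where
    field
      exponent   : Fin n → Fin n → ℤ
      sign       : Sign
      represents : ∀ z → Distinct F z → f z ≈ signedMonomial sign exponent z

  open SignedMonomial public

  u-≉0 : ∀ {z : Configuration} → Distinct F z → NonzeroOnChords (u F z)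
  u-≉0 z-distinct k l kl with chord-distinct kl
  ... | _ , k≢l⁺ , k≢l , k⁺≢l⁺ , k⁺≢l , _ =
    crossRatio-≉0 z-distinct k≢l⁺ k⁺≢l k≢l k⁺≢l⁺

  signedMonomial-* : ∀ {z} → Distinct F z → ∀ s t e e′ →
                     signedMonomial s e z * signedMonomial t e′ z ≈
                     signedMonomial (s Sign.* t) (λ k l → e k l ℤ.+ e′ k l) z
  signedMonomial-* z-distinct s t e e′ =
    trans (applySign-* s t _ _) (applySign-cong (s Sign.* t) (sym (monomial-+ (u-≉0 z-distinct) e e′)))

  signedMonomial-negate : ∀ {z} → Distinct F z → ∀ s e →
                          signedMonomial s e z * signedMonomial s (λ k l → ℤ.- e k l) z ≈ 1#
  signedMonomial-negate {z} z-distinct s e = begin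
    signedMonomial s e z * signedMonomial s (λ k l → ℤ.- e k l) z
      ≈⟨ signedMonomial-* z-distinct s s e _ ⟩
    signedMonomial (s Sign.* s) e-e z
      ≡⟨ ≡.cong (λ t → signedMonomial t e-e z) (s*s≡+ s) ⟩
    monomial F (u F z) e-e
      ≈⟨ monomial-cong (u F z) (λ k l → ℤ.+-inverseʳ (e k l)) ⟩
    monomial F (u F z) (λ _ _ → + 0)
      ≈⟨ monomial-0 (u F z) ⟩
    1#
      ∎
    where
    e-e = λ k l → e k l ℤ.+ ℤ.- e k l

  SignedMonomial-u : ∀ {p q} → IsChord p q → SignedMonomial (λ z → u F z p q)
  SignedMonomial-u {p} {q} pq = record
    { exponent   = indicator p q
    ; sign       = Sign.+
    ; represents = λ z _ → sym (monomial-indicator (u F z) pq)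
    }

  SignedMonomial-neg : ∀ {f} → SignedMonomial f → SignedMonomial (λ z → - f z)
  SignedMonomial-neg M = record
    { exponent   = exponent M
    ; sign       = Sign.opposite (sign M)
    ; represents = λ z z-distinct →
        trans (-‿cong (represents M z z-distinct)) (sym (applySign-opposite (sign M) _))
    }

  module _ {f g : Configuration → Carrier} where

    SignedMonomial-cong : SignedMonomial f → (∀ z → Distinct F z → f z ≈ g z) → SignedMonomial g
    SignedMonomial-cong M f≈g = record
      { exponent   = exponent M
      ; sign       = sign M
      ; represents = λ z z-distinct → trans (sym (f≈g z z-distinct)) (represents M z z-distinct)
      }

    SignedMonomial-* : SignedMonomial f → SignedMonomial g → SignedMonomial (λ z → f z * g z)
    SignedMonomial-* M M′ = record
      { exponent   = λ k l → exponent M k l ℤ.+ exponent M′ k l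
      ; sign       = sign M Sign.* sign M′
      ; represents = λ z z-distinct →
          trans (*-cong (represents M z z-distinct) (represents M′ z z-distinct))
                (signedMonomial-* z-distinct (sign M) (sign M′) (exponent M) (exponent M′))
      }

    SignedMonomial-reciprocal : SignedMonomial f → (∀ z → Distinct F z → f z * g z ≈ 1#) →
                                SignedMonomial g
    SignedMonomial-reciprocal M fg≈1 = record
      { exponent   = λ k l → ℤ.- exponent M k l
      ; sign       = sign M
      ; represents = λ z z-distinct → inverse-unique (fg≈1 z z-distinct)
          (trans (*-congʳ (represents M z z-distinct))
                 (signedMonomial-negate z-distinct (sign M) (exponent M)))
      }

  MonomialCR : Fin n → Fin n → Fin n → Fin n → Set (c ⊔ ℓ)
  MonomialCR a b c d = SignedMonomial (λ z → crossRatio F z a b c d)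

  module _ {a b c d : Fin n} where

    MonomialCR-≡ : ∀ {a′ b′ c′ d′} → a ≡ a′ → b ≡ b′ → c ≡ c′ → d ≡ d′ →
                   MonomialCR a b c d → MonomialCR a′ b′ c′ d′
    MonomialCR-≡ ≡.refl ≡.refl ≡.refl ≡.refl M = M

    MonomialCR-cocycleʳ : ∀ {e} → a ≢ d → b ≢ c → a ≢ e → b ≢ d →
                          MonomialCR a b c d → MonomialCR a b d e → MonomialCR a b c e
    MonomialCR-cocycleʳ a≢d b≢c a≢e b≢d M M′ = SignedMonomial-cong (SignedMonomial-* M M′)
      λ z z-distinct → crossRatio-cocycleʳ z-distinct a≢d b≢c a≢e b≢d

    MonomialCR-cocycleˡ : ∀ {x} → a ≢ d → b ≢ c → b ≢ d → x ≢ c →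
                          MonomialCR a b c d → MonomialCR b x c d → MonomialCR a x c d
    MonomialCR-cocycleˡ a≢d b≢c b≢d x≢c M M′ = SignedMonomial-cong (SignedMonomial-* M M′)
      λ z z-distinct → crossRatio-cocycleˡ z-distinct a≢d b≢c b≢d x≢c

    MonomialCR-abdc : a ≢ c → b ≢ d → a ≢ d → b ≢ c → MonomialCR a b c d → MonomialCR a b d c
    MonomialCR-abdc a≢c b≢d a≢d b≢c M = SignedMonomial-reciprocal M
      λ z z-distinct → crossRatio-reciprocal z-distinct a≢c b≢d a≢d b≢c

    MonomialCR-badc : a ≢ d → b ≢ c → MonomialCR a b c d → MonomialCR b a d c
    MonomialCR-badc a≢d b≢c M = SignedMonomial-cong M
      λ z z-distinct → crossRatio-badc z-distinct a≢d b≢c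

    MonomialCR-cdab : a ≢ d → b ≢ c → MonomialCR a b c d → MonomialCR c d a b
    MonomialCR-cdab a≢d b≢c M = SignedMonomial-cong M
      λ z z-distinct → crossRatio-cdab z-distinct a≢d b≢c

    MonomialCR-dcba : a ≢ d → b ≢ c → MonomialCR a b c d → MonomialCR d c b a
    MonomialCR-dcba a≢d b≢c M = SignedMonomial-cong M λ z z-distinct →
      trans (crossRatio-cdab z-distinct a≢d b≢c) (crossRatio-badc z-distinct (≢-sym b≢c) (≢-sym a≢d))

    MonomialCR-acbd : a ≢ c → b ≢ d → a ≢ d → b ≢ c →
                      MonomialCR a d b c → MonomialCR a b c d → MonomialCR a c b d
    MonomialCR-acbd a≢c b≢d a≢d b≢c M M′ =
      SignedMonomial-cong (SignedMonomial-neg (SignedMonomial-* M M′)) λ z z-distinct →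
        trans (-‿cong (crossRatio-three-term z-distinct a≢c b≢d a≢d b≢c)) (-‿involutive _)

module ProductFormula {c ℓ : Level} (F : Field c ℓ) (m : ℕ) where
  open Positions m
  open SignedMonomials F N

  -- The arc of positions i, i+1, …, l (mod N), shorter than a full turn.
  module Arc (i l : ℕ) (l≤N : l ≤ N) (l<N+i : l < N ℕ.+ i) where

    apart : ∀ {x y} → i ≤ x → x < y → y ≤ l → pos x ≢ pos y
    apart i≤x x<y y≤l = pos-distinct x<y (ℕ.≤-trans y≤l l≤N)
      (ℕ.<-≤-trans (ℕ.≤-<-trans y≤l l<N+i) (ℕ.+-monoʳ-≤ N i≤x))

    u-arc : ∀ {a b} → i ≤ a → suc a < b → suc b ≤ l →
            MonomialCR (pos a) (pos (suc a)) (pos (suc b)) (pos b)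
    u-arc {a} {b} i≤a a⁺<b b<l =
      MonomialCR-≡ ≡.refl (next-pos a) (next-pos b) ≡.refl (SignedMonomial-u chord)
      where
      a<b = ℕ.<-trans (ℕ.n<1+n a) a⁺<b
      b<N = ℕ.≤-trans b<l l≤N
      chord : IsChord (pos a) (pos b)
      chord = Equivalence.from IsChord⇔
        ( ≡.subst₂ _<_ (≡.sym (toℕ-pos-< (ℕ.<-trans a<b b<N))) (≡.sym (toℕ-pos-< b<N)) a<b
        , ≢-sym (≡.subst (_≢ pos b) (≡.sym (next-pos a))
                         (apart (ℕ.m≤n⇒m≤1+n i≤a) a⁺<b (ℕ.<⇒≤ b<l)))
        , ≡.subst (pos a ≢_) (≡.sym (next-pos b)) (apart i≤a (ℕ.m<n⇒m<1+n a<b) b<l) )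

    -- [a, a+1 | c, b] = u_{a,b} ⋯ u_{a,c-1}, telescoping in c.
    adjacent : ∀ {a b c} → i ≤ a → suc a < b → b < c → c ≤ l →
               MonomialCR (pos a) (pos (suc a)) (pos c) (pos b)
    adjacent {a} {b} {suc c} i≤a a⁺<b b<c⁺ c<l with ℕ.m≤n⇒m<n∨m≡n (ℕ.≤-pred b<c⁺)
    ... | inj₂ ≡.refl = u-arc i≤a a⁺<b c<l
    ... | inj₁ b<c =
      MonomialCR-cocycleʳ (apart i≤a a<c c≤l) (apart i≤a⁺ (s≤s a<c) c<l)
                          (apart i≤a a<b (ℕ.≤-trans (ℕ.<⇒≤ b<c) c≤l)) (apart i≤a⁺ a⁺<c c≤l)
                          (u-arc i≤a a⁺<c c<l) (adjacent i≤a a⁺<b b<c c≤l)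
      where
      i≤a⁺ = ℕ.m≤n⇒m≤1+n i≤a
      a<b  = ℕ.<-trans (ℕ.n<1+n a) a⁺<b
      a<c  = ℕ.<-trans a<b b<c
      a⁺<c = ℕ.<-trans a⁺<b b<c
      c≤l  = ℕ.<⇒≤ c<l

    -- [a b | d c] = ∏ u_xy over a ≤ x < b, c ≤ y < d, telescoping in b.
    product : ∀ {a b c d} → i ≤ a → a < b → b < c → c < d → d ≤ l →
              MonomialCR (pos a) (pos b) (pos d) (pos c)
    product {a} {suc b} i≤a a<b⁺ b⁺<c c<d d≤l with ℕ.m≤n⇒m<n∨m≡n (ℕ.≤-pred a<b⁺)
    ... | inj₂ ≡.refl = adjacent i≤a b⁺<c c<d d≤l
    ... | inj₁ a<b =
      MonomialCR-cocycleˡ (apart i≤a (ℕ.<-trans a<b b<c) c≤l) (apart i≤b (ℕ.<-trans b<c c<d) d≤l)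
                          (apart i≤b b<c c≤l) (apart (ℕ.m≤n⇒m≤1+n i≤b) (ℕ.<-trans b⁺<c c<d) d≤l)
                          (product i≤a a<b b<c c<d d≤l) (adjacent i≤b b⁺<c c<d d≤l)
      where
      i≤b = ℕ.≤-trans i≤a (ℕ.<⇒≤ a<b)
      b<c = ℕ.<-trans (ℕ.n<1+n b) b⁺<c
      c≤l = ℕ.≤-trans (ℕ.<⇒≤ c<d) d≤l

  monomialCR-ijlk : ∀ {i j k l : Fin N} → i Fin.< j → j Fin.< k → k Fin.< l → MonomialCR i j l k
  monomialCR-ijlk {i} {j} {k} {l} i<j j<k k<l =
    MonomialCR-≡ (pos-toℕ i) (pos-toℕ j) (pos-toℕ l) (pos-toℕ k)
      (Arc.product (toℕ i) (toℕ l) (ℕ.<⇒≤ (toℕ<n l))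
                   (ℕ.<-≤-trans (toℕ<n l) (ℕ.m≤m+n N (toℕ i)))
                   ℕ.≤-refl i<j j<k k<l ℕ.≤-refl)

  monomialCR-jk0l : ∀ {j k l : Fin N} → 0 < toℕ j → j Fin.< k → k Fin.< l → MonomialCR j k Fin.zero l
  monomialCR-jk0l {j} {k} {l} 0<j j<k k<l =
    MonomialCR-≡ (pos-toℕ j) (pos-toℕ k) pos-N (pos-toℕ l)
      (Arc.product (toℕ j) N ℕ.≤-refl (ℕ.m<m+n N 0<j) ℕ.≤-refl j<k k<l (toℕ<n l) ℕ.≤-refl)

  monomialCR-jkil : ∀ {i j k l : Fin N} → i Fin.< j → j Fin.< k → k Fin.< l → MonomialCR j k i l
  monomialCR-jkil {Fin.zero}  0<j j<k k<l = monomialCR-jk0l 0<j j<k k<l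
  monomialCR-jkil {Fin.suc i} i<j j<k k<l =
    MonomialCR-cocycleʳ (≢-sym (<⇒≢ 0<j)) (≢-sym (<⇒≢ (ℕ.<-trans i<j j<k)))
                        (<⇒≢ (ℕ.<-trans j<k k<l)) (≢-sym (<⇒≢ (ℕ.<-trans 0<j j<k)))
      (MonomialCR-dcba (<⇒≢ 0<j) (<⇒≢ (ℕ.<-trans i<j j<k)) (monomialCR-ijlk z<s i<j j<k))
      (monomialCR-jk0l 0<j j<k k<l)
    where
    0<j = ℕ.<-trans z<s i<j

  module Ordered {i j k l : Fin N} (i<j : i Fin.< j) (j<k : j Fin.< k) (k<l : k Fin.< l) where
    i≢j = <⇒≢ i<j
    j≢k = <⇒≢ j<k
    k≢l = <⇒≢ k<l
    i≢k = <⇒≢ (ℕ.<-trans i<j j<k)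
    j≢l = <⇒≢ (ℕ.<-trans j<k k<l)
    i≢l = <⇒≢ (ℕ.<-trans i<j (ℕ.<-trans j<k k<l))

    ijlk : MonomialCR i j l k
    ijlk = monomialCR-ijlk i<j j<k k<l

    ijkl : MonomialCR i j k l
    ijkl = MonomialCR-abdc i≢l j≢k i≢k j≢l ijlk

    iljk : MonomialCR i l j k
    iljk = MonomialCR-cdab j≢l (≢-sym i≢k) (monomialCR-jkil i<j j<k k<l)

    ilkj : MonomialCR i l k j
    ilkj = MonomialCR-abdc i≢j (≢-sym k≢l) i≢k (≢-sym j≢l) iljk

    ikjl : MonomialCR i k j l
    ikjl = MonomialCR-acbd i≢k j≢l i≢l j≢k iljk ijkl

    iklj : MonomialCR i k l j
    iklj = MonomialCR-abdc i≢j k≢l i≢l (≢-sym j≢k) ikjl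

  monomialCR-least-first : ∀ {a b c d : Fin N} → a Fin.< b → a Fin.< c → a Fin.< d →
                           b ≢ c → b ≢ d → c ≢ d → MonomialCR a b c d
  monomialCR-least-first {b = b} {c} {d} a<b a<c a<d b≢c b≢d c≢d with <-cmp b c | <-cmp c d | <-cmp b d
  ... | tri≈ _ b≡c _ | _            | _            = ⊥-elim (b≢c b≡c)
  ... | _            | tri≈ _ c≡d _ | _            = ⊥-elim (c≢d c≡d)
  ... | _            | _            | tri≈ _ b≡d _ = ⊥-elim (b≢d b≡d)
  ... | tri< b<c _ _ | tri< c<d _ _ | _            = Ordered.ijkl a<b b<c c<d
  ... | tri< b<c _ _ | tri> _ _ d<c | tri< b<d _ _ = Ordered.ijlk a<b b<d d<c
  ... | tri< b<c _ _ | tri> _ _ d<c | tri> _ _ d<b = Ordered.iklj a<d d<b b<c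
  ... | tri> _ _ c<b | tri< c<d _ _ | tri< b<d _ _ = Ordered.ikjl a<c c<b b<d
  ... | tri> _ _ c<b | tri< c<d _ _ | tri> _ _ d<b = Ordered.iljk a<c c<d d<b
  ... | tri> _ _ c<b | tri> _ _ d<c | _            = Ordered.ilkj a<d d<c c<b

  monomialCR-<< : ∀ {a b c d : Fin N} → a Fin.< b → c Fin.< d → Distinct4 a b c d → MonomialCR a b c d
  monomialCR-<< {a} {b} {c} {d} a<b c<d (a≢b , a≢c , a≢d , b≢c , b≢d , c≢d) with <-cmp a c
  ... | tri≈ _ a≡c _ = ⊥-elim (a≢c a≡c)
  ... | tri< a<c _ _ = monomialCR-least-first a<b a<c (ℕ.<-trans a<c c<d) b≢c b≢d c≢d
  ... | tri> _ _ c<a = MonomialCR-cdab (≢-sym b≢c) (≢-sym a≢d)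
    (monomialCR-least-first c<d c<a (ℕ.<-trans c<a a<b) (≢-sym a≢d) (≢-sym b≢d) a≢b)

  monomialCR-<> : ∀ {a b c d : Fin N} → a Fin.< b → d Fin.< c → Distinct4 a b c d → MonomialCR a b c d
  monomialCR-<> {a} {b} {c} {d} a<b d<c (a≢b , a≢c , a≢d , b≢c , b≢d , c≢d) with <-cmp a d
  ... | tri≈ _ a≡d _ = ⊥-elim (a≢d a≡d)
  ... | tri< a<d _ _ = monomialCR-least-first a<b (ℕ.<-trans a<d d<c) a<d b≢c b≢d c≢d
  ... | tri> _ _ d<a = MonomialCR-dcba (≢-sym a≢d) (≢-sym b≢c)
    (monomialCR-least-first d<c (ℕ.<-trans d<a a<b) d<a (≢-sym b≢c) (≢-sym a≢c) (≢-sym a≢b))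

  monomialCR : ∀ {a b c d : Fin N} → Distinct4 a b c d → MonomialCR a b c d
  monomialCR {a} {b} {c} {d} D@(a≢b , _ , a≢d , b≢c , _ , c≢d) with <-cmp a b | <-cmp c d
  ... | tri≈ _ a≡b _ | _            = ⊥-elim (a≢b a≡b)
  ... | _            | tri≈ _ c≡d _ = ⊥-elim (c≢d c≡d)
  ... | tri< a<b _ _ | tri< c<d _ _ = monomialCR-<< a<b c<d D
  ... | tri< a<b _ _ | tri> _ _ d<c = monomialCR-<> a<b d<c D
  ... | tri> _ _ b<a | tri> _ _ d<c = MonomialCR-badc b≢c a≢d (monomialCR-<< b<a d<c (Distinct4-badc D))
  ... | tri> _ _ b<a | tri< c<d _ _ = MonomialCR-badc b≢c a≢d (monomialCR-<> b<a c<d (Distinct4-badc D))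

⟨$⟩ʳ-injective : ∀ {n} (π : Permutation′ n) → Injective _≡_ _≡_ (π ⟨$⟩ʳ_)
⟨$⟩ʳ-injective π πx≡πy =
  ≡.trans (≡.sym (inverseˡ π)) (≡.trans (≡.cong (π ⟨$⟩ˡ_) πx≡πy) (inverseˡ π))

module _ {c ℓ : Level} (F : Field c ℓ) where
  open Field F using (Carrier; _≈_)
  open SignedMonomials F using (MonomialCR; SignedMonomial; exponent; sign; represents)

  crossRatio-monomial : ∀ {n} {a b c d : Fin n} → Distinct4 a b c d → MonomialCR n a b c d
  crossRatio-monomial {zero} {a = ()}
  crossRatio-monomial {suc m} = ProductFormula.monomialCR F m

  uα-monomial : ∀ {n} (π : Permutation′ n) p q → IsChord p q → SignedMonomial n (λ z → uα F π z p q)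
  uα-monomial π p q pq = crossRatio-monomial (Distinct4-map (⟨$⟩ʳ-injective π) (chord-distinct pq))

  -- Off chords the exponents are never inspected; they are set to 0.
  chordwise : ∀ {n} {f : Fin n → Fin n → (Fin n → Carrier) → Carrier} →
    (∀ p q → IsChord p q → SignedMonomial n (f p q)) →
    Σ (Fin n → Fin n → Fin n → Fin n → ℤ) λ E → Σ (Fin n → Fin n → Sign) λ s →
      ∀ z → Distinct F z → ∀ p q → IsChord p q →
      f p q z ≈ applySign F (s p q) (monomial F (u F z) (E p q))
  chordwise {n} {f} M = (λ p q → proj₁ (pick p q)) , (λ p q → proj₁ (proj₂ (pick p q))) ,
    λ z z-distinct p q pq → proj₂ (proj₂ (pick p q)) pq z z-distinct
    where
    pick : ∀ p q → Σ (Fin n → Fin n → ℤ) λ E → Σ Sign λ s →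
           IsChord p q → ∀ z → Distinct F z → f p q z ≈ applySign F s (monomial F (u F z) E)
    pick p q with T? (isChord p q)
    ... | yes pq = exponent (M p q pq) , sign (M p q pq) , λ _ → represents (M p q pq)
    ... | no ¬pq = (λ _ _ → + 0) , Sign.+ , λ pq → ⊥-elim (¬pq pq)

  Distinct-∘ : ∀ {n} {g : Fin n → Fin n} {z : Fin n → Carrier} → Injective _≡_ _≡_ g →
               Distinct F z → Distinct F (z ∘ g)
  Distinct-∘ g-injective z-distinct i j i≢j = z-distinct _ _ (i≢j ∘ g-injective)

  uα-flip : ∀ {n} (α : Permutation′ n) (z : Fin n → Carrier) k l →
            uα F (flip α) (z ∘ (α ⟨$⟩ʳ_)) k l ≡ u F z k l
  uα-flip α z k l = crossRatio-cong (inverseʳ α) (inverseʳ α) (inverseʳ α) (inverseʳ α)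
    where
    crossRatio-cong : ∀ {a b c d a′ b′ c′ d′} →
                      a ≡ a′ → b ≡ b′ → c ≡ c′ → d ≡ d′ →
                      crossRatio F z a b c d ≡ crossRatio F z a′ b′ c′ d′
    crossRatio-cong ≡.refl ≡.refl ≡.refl ≡.refl = ≡.refl

lemma2p4 : {c ℓ : Level} (n : ℕ) (α : DihedralOrdering n) (F : Field c ℓ) →
    Σ (Fin n → Fin n → Fin n → Fin n → ℤ) λ E →
    Σ (Fin n → Fin n → Sign) λ s →
    Σ (Fin n → Fin n → Fin n → Fin n → ℤ) λ E′ →
    Σ (Fin n → Fin n → Sign) λ s′ →
    (z : Fin n → Field.Carrier F) → Distinct F z →
      ((p q : Fin n) → IsChord p q →
         Field._≈_ F (uα F α z p q) (applySign F (s p q) (monomial F (u F z) (E p q))))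
      ×
      ((k l : Fin n) → IsChord k l →
         Field._≈_ F (u F z k l) (applySign F (s′ k l) (monomial F (uα F α z) (E′ k l))))
lemma2p4 n α F with chordwise F (uα-monomial F α) | chordwise F (uα-monomial F (flip α))
... | E , s , forward | E′ , s′ , backward = E , s , E′ , s′ , λ z z-distinct →
  forward z z-distinct ,
  λ k l kl → Field.trans F (Field.reflexive F (≡.sym (uα-flip F α z k l)))
    (backward (z ∘ (α ⟨$⟩ʳ_)) (Distinct-∘ F (⟨$⟩ʳ-injective α) z-distinct) k l kl)
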